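{- For $k\ge0$ let $f_k(z)$ (resp. $g_k(z)$) be the generating function whose coefficient of $z^m$ is the number of partial zigzag knight's paths of length $m$ ending at height $k$ whose last step is an up-step $N$ or $E$ (resp. a down-step $\bar N$ or $\bar E$), the empty path being counted in $f_0$. Then $[z^0]f_0=1$ and, for all $n\ge1$, $$[z^{2n-1}]f_k=\frac{2k-1}{n+k}\binom{2n}{n-k+1}\ (k\ge1),\qquad [z^{2n}]g_0=\frac{1}{n+2}\binom{2n+2}{n+1},\qquad [z^{2n}]g_k=\frac{k+1}{n+1}\binom{2n+2}{n-k}\ (k\ge1).$$ All other coefficients are $0$: namely $[z^m]f_0=0$ for $m\ge1$, $[z^{2n}]f_k=0$ for $n\ge0,k\ge1$, $[z^{2n-1}]g_k=0$ for $n\ge1,k\ge0$, and $[z^0]g_k=0$ for $k\ge0$.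
   Context: Let $N=(1,2)$, $\bar N=(1,-2)$, $E=(2,1)$, $\bar E=(2,-1)$; $N,E$ are up-steps and $\bar N,\bar E$ are down-steps. A knight's path is a lattice path in $\mathbb N^2$ starting at $(0,0)$, ending on the $x$-axis, with steps in $\{N,\bar N,E,\bar E\}$. A zigzag knight's path is a knight's path in which consecutive steps alternate between up-steps and down-steps. A partial zigzag knight's path is a prefix (possibly empty) of a zigzag knight's path. The length of a path is its number of steps; the height of a point is its ordinate. $[z^m]h$ denotes the coefficient of $z^m$ in $h$; $\binom{a}{b}=0$ if $b<0$ or $b>a$. -}

module Defs where

open import Data.Nat using (ℕ; zero; suc)
open import Data.Nat.Combinatorics using (_C_)
open import Data.Integer using (ℤ; +_; -[1+_]; _+_; _≤_) renaming (_-_ to _-ℤ_)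
open import Data.Bool using (Bool; true; false)
open import Data.List using (List; []; _∷_; _++_; length)
open import Data.List.Membership.Propositional using (_∈_)
open import Data.List.Relation.Unary.Unique.Propositional using (Unique)
open import Data.Product using (Σ; ∃; _×_)
open import Data.Unit using (⊤)
open import Data.Empty using (⊥)
open import Data.Sum using (_⊎_)
open import Function.Bundles using (_⇔_)
open import Relation.Binary.PropositionalEquality using (_≡_; _≢_)

-- Steps: N = (1,2), N̄ = (1,-2), E = (2,1), Ē = (2,-1)
data Step : Set where
  N N̄ E Ē : Step

up : Step → Bool
up N = true
up E = true
up N̄ = false
up Ē = false

-- vertical displacement (the horizontal one is always positive, so the
-- abscissa is automatically in ℕ)
dy : Step → ℤ
dy N = + 2
dy E = + 1
dy N̄ = -[1+ 1 ]
dy Ē = -[1+ 0 ]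

Path : Set
Path = List Step

StaysNonneg : ℤ → Path → Set
StaysNonneg h [] = ⊤
StaysNonneg h (s ∷ p) = (+ 0 ≤ h + dy s) × StaysNonneg (h + dy s) p

endFrom : ℤ → Path → ℤ
endFrom h [] = h
endFrom h (s ∷ p) = endFrom (h + dy s) p

endHeight : Path → ℤ
endHeight = endFrom (+ 0)

Alternating : Path → Set
Alternating [] = ⊤
Alternating (s ∷ []) = ⊤
Alternating (s ∷ t ∷ p) = (up s ≢ up t) × Alternating (t ∷ p)

KnightPath : Path → Set
KnightPath p = StaysNonneg (+ 0) p × endHeight p ≡ + 0

ZigzagKnightPath : Path → Set
ZigzagKnightPath p = KnightPath p × Alternating p

PartialZigzag : Path → Set
PartialZigzag p = ∃ λ q → ZigzagKnightPath (p ++ q)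

LastUpOrEmpty : Path → Set
LastUpOrEmpty [] = ⊤
LastUpOrEmpty (s ∷ []) = up s ≡ true
LastUpOrEmpty (_ ∷ t ∷ p) = LastUpOrEmpty (t ∷ p)

LastDown : Path → Set
LastDown [] = ⊥
LastDown (s ∷ []) = up s ≡ false
LastDown (_ ∷ t ∷ p) = LastDown (t ∷ p)

HasCount : (Path → Set) → ℕ → Set
HasCount P c = Σ (List Path) λ L → Unique L × ((p : Path) → (p ∈ L ⇔ P p)) × length L ≡ c

FPath : ℕ → ℕ → Path → Set
FPath m k p = PartialZigzag p × length p ≡ m × endHeight p ≡ + k × LastUpOrEmpty p

GPath : ℕ → ℕ → Path → Set
GPath m k p = PartialZigzag p × length p ≡ m × endHeight p ≡ + k × LastDown p

fCoef : ℕ → ℕ → ℕ → Set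
fCoef m k c = HasCount (FPath m k) c

gCoef : ℕ → ℕ → ℕ → Set
gCoef m k c = HasCount (GPath m k) c

-- binomial coefficient with integer lower index (0 if b < 0 or b > a)
binomℤ : ℕ → ℤ → ℕ
binomℤ a (+ b) = a C b
binomℤ a -[1+ _ ] = 0

-- A path is a prefix of a zigzag knight's path exactly when it alternates and never
-- goes below the x-axis: such a path returns to the axis by appending Ē (if its last
-- step goes up) and then pairs E N̄, each lowering the height by one. Removing the last
-- step therefore gives  [z^(m+1)] f_k = [z^m] g_(k-2) + [z^m] g_(k-1)  and
-- [z^(m+1)] g_k = [z^m] f_(k+2) + [z^m] f_(k+1), which after doubling heights is the
-- recursion of the ballot numbers: [z^m] g_k counts the ±1 paths of length m+1 that
-- never go below 0 and end at height 2k+1, and [z^m] f_(k+1) those ending at height 2k.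
-- The reflection principle gives ballot(h + 2j, h) = C(h + 2j, j) - C(h + 2j, j - 1),
-- and absorption identities turn this into the stated closed forms.
module Submission where

open import Defs
open import Data.Nat using (ℕ; zero; suc; _+_; _*_; _∸_; _≥_; _<_; z≤n; s≤s)
open import Data.Nat.Properties
open import Data.Nat.Combinatorics using (_C_; nC1≡n; nCk≡nC[n∸k]; nCk+nC[k+1]≡[n+1]C[k+1])
open import Data.Nat.Tactic.RingSolver using (solve-∀)
open import Algebra.Properties.CommutativeSemigroup *-commutativeSemigroup using (x∙yz≈y∙xz)
open import Data.Integer using (ℤ; +_; -[1+_]; -_; _≤_; +≤+) renaming (_-_ to _-ℤ_; _+_ to _+ℤ_)
import Data.Integer.Properties as ℤ
import Data.Integer.Tactic.RingSolver as ℤ-Solver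
open import Data.Bool using (Bool; true; false; not)
open import Data.Bool.Properties using (not-¬; ¬-not)
open import Data.List using (List; []; _∷_; _++_; _∷ʳ_; [_]; length; map; initLast; _∷ʳ′_)
open import Data.List.Properties using (length-++; length-map; ++-assoc; ++-identityʳ; ∷ʳ-injectiveˡ; ∷ʳ-injectiveʳ)
open import Data.List.Membership.Propositional using (_∈_)
open import Data.List.Membership.Propositional.Properties using (∈-map⁺; ∈-map⁻; ∈-++⁺ˡ; ∈-++⁺ʳ; ∈-++⁻)
open import Data.List.Relation.Unary.Any using (here; there)
open import Data.List.Relation.Unary.All using ([])
open import Data.List.Relation.Unary.AllPairs using ([]; _∷_)
open import Data.List.Relation.Unary.Unique.Propositional.Properties using (map⁺; ++⁺)
open import Data.Product using (Σ; ∃; _×_; _,_; proj₁; proj₂)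
open import Data.Sum using (_⊎_; inj₁; inj₂)
import Data.Sum as Sum
open import Data.Unit using (⊤; tt)
open import Data.Empty using (⊥; ⊥-elim)
open import Function using (_∘′_; case_of_; id)
open import Function.Bundles using (_⇔_; mk⇔; Equivalence)
open import Function.Properties.Equivalence using () renaming (sym to ⇔-sym)
open import Relation.Nullary using (¬_)
open import Relation.Binary.PropositionalEquality using (_≡_; _≢_; refl; sym; trans; cong; cong₂; subst; module ≡-Reasoning)

open ≡-Reasoning
open Equivalence using (to; from)

-- Binomial identities

[k+1]*[n+1]C[k+1]≡[n+1]*nCk : ∀ n k → suc k * (suc n C suc k) ≡ suc n * (n C k)
[k+1]*[n+1]C[k+1]≡[n+1]*nCk zero    zero    = refl
[k+1]*[n+1]C[k+1]≡[n+1]*nCk zero    (suc k) = *-zeroʳ (suc (suc k))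
[k+1]*[n+1]C[k+1]≡[n+1]*nCk (suc n) zero    = begin
  1 * (suc (suc n) C 1) ≡⟨ *-identityˡ _ ⟩
  suc (suc n) C 1       ≡⟨ nC1≡n (suc (suc n)) ⟩
  suc (suc n)           ≡⟨ *-identityʳ _ ⟨
  suc (suc n) * 1       ∎
[k+1]*[n+1]C[k+1]≡[n+1]*nCk (suc n) (suc k) = begin
  suc (suc k) * (suc (suc n) C suc (suc k))
    ≡⟨ cong (suc (suc k) *_) (nCk+nC[k+1]≡[n+1]C[k+1] (suc n) (suc k)) ⟨
  suc (suc k) * (X + Y)
    ≡⟨ *-distribˡ-+ (suc (suc k)) X Y ⟩
  (X + suc k * X) + suc (suc k) * Y
    ≡⟨ cong₂ (λ u v → (X + u) + v) ([k+1]*[n+1]C[k+1]≡[n+1]*nCk n k)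
                                    ([k+1]*[n+1]C[k+1]≡[n+1]*nCk n (suc k)) ⟩
  (X + suc n * (n C k)) + suc n * (n C suc k)
    ≡⟨ +-assoc X _ _ ⟩
  X + (suc n * (n C k) + suc n * (n C suc k))
    ≡⟨ cong (_+_ X) (*-distribˡ-+ (suc n) (n C k) (n C suc k)) ⟨
  X + suc n * (n C k + n C suc k)
    ≡⟨ cong (λ z → X + suc n * z) (nCk+nC[k+1]≡[n+1]C[k+1] n k) ⟩
  X + suc n * X ∎
  where
  X = suc n C suc k
  Y = suc n C suc (suc k)

[m+n]Cm≡[m+n]Cn : ∀ m n → (m + n) C m ≡ (m + n) C n
[m+n]Cm≡[m+n]Cn m n = begin
  (m + n) C m             ≡⟨ nCk≡nC[n∸k] (m≤m+n m n) ⟩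
  (m + n) C (m + n ∸ m)   ≡⟨ cong ((m + n) C_) (m+n∸m≡n m n) ⟩
  (m + n) C n             ∎

[m+1]*[m+n+1]Cn≡[m+n+1]*[m+n]Cn : ∀ m n → suc m * (suc (m + n) C n) ≡ suc (m + n) * ((m + n) C n)
[m+1]*[m+n+1]Cn≡[m+n+1]*[m+n]Cn m n = begin
  suc m * ((suc m + n) C n)     ≡⟨ cong (suc m *_) ([m+n]Cm≡[m+n]Cn (suc m) n) ⟨
  suc m * ((suc m + n) C suc m)   ≡⟨ [k+1]*[n+1]C[k+1]≡[n+1]*nCk (m + n) m ⟩
  suc (m + n) * ((m + n) C m)   ≡⟨ cong (suc (m + n) *_) ([m+n]Cm≡[m+n]Cn m n) ⟩
  suc (m + n) * ((m + n) C n)   ∎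

-- binomℤ n (+ k -ℤ + 1) is C(n, k - 1) with C(n, -1) = 0, so these also hold at k = 0.
[n+1]Ck≡nCk+nC[k-1] : ∀ n k → suc n C k ≡ n C k + binomℤ n (+ k -ℤ + 1)
[n+1]Ck≡nCk+nC[k-1] n zero    = refl
[n+1]Ck≡nCk+nC[k-1] n (suc k) = sym (trans (+-comm (n C suc k) (n C k)) (nCk+nC[k+1]≡[n+1]C[k+1] n k))

[n+1]*nC[k-1]≡k*[n+1]Ck : ∀ n k → suc n * binomℤ n (+ k -ℤ + 1) ≡ k * (suc n C k)
[n+1]*nC[k-1]≡k*[n+1]Ck n zero    = *-zeroʳ (suc n)
[n+1]*nC[k-1]≡k*[n+1]Ck n (suc k) = sym ([k+1]*[n+1]C[k+1]≡[n+1]*nCk n k)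

-- Ballot numbers

-- ballot m h: the number of ±1 paths of length m from height 0 to height h that never go below 0.
ballot : ℕ → ℕ → ℕ
ballot zero    zero    = 1
ballot zero    (suc h) = 0
ballot (suc m) zero    = ballot m 1
ballot (suc m) (suc h) = ballot m h + ballot m (suc (suc h))

ballot-vanishes : ∀ {m h} → m < h → ballot m h ≡ 0
ballot-vanishes {zero}  {suc h} _         = refl
ballot-vanishes {suc m} {suc h} (s≤s m<h) =
  cong₂ _+_ (ballot-vanishes m<h) (ballot-vanishes (m<n⇒m<1+n (m<n⇒m<1+n m<h)))

ballot-diagonal : ∀ h → ballot h h ≡ 1
ballot-diagonal zero    = refl
ballot-diagonal (suc h) = cong₂ _+_ (ballot-diagonal h) (ballot-vanishes (m<n⇒m<1+n (n<1+n h)))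

ballot-reflection : ∀ j h → ballot (h + 2 * j) h + binomℤ (h + 2 * j) (+ j -ℤ + 1) ≡ (h + 2 * j) C j
ballot-reflection zero    h rewrite +-identityʳ h = cong (_+ 0) (ballot-diagonal h)
ballot-reflection (suc j) zero =
  subst (λ n → ballot n 0 + n C j ≡ n C suc j) (sym (*-suc 2 j)) (begin
  ballot M 1 + suc M C j                        ≡⟨ cong (_+_ (ballot M 1)) ([n+1]Ck≡nCk+nC[k-1] M j) ⟩
  ballot M 1 + (M C j + binomℤ M (+ j -ℤ + 1))  ≡⟨ swap-last (ballot M 1) (M C j) _ ⟩
  (ballot M 1 + binomℤ M (+ j -ℤ + 1)) + M C j  ≡⟨ cong (_+ M C j) (ballot-reflection j 1) ⟩
  M C j + M C j                                 ≡⟨ cong (_+_ (M C j)) middle-symmetry ⟩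
  M C j + M C suc j                             ≡⟨ nCk+nC[k+1]≡[n+1]C[k+1] M j ⟩
  suc M C suc j                                 ∎)
  where
  M = suc (2 * j)
  swap-last : ∀ a b c → a + (b + c) ≡ (a + c) + b
  swap-last = solve-∀
  j+[1+j]≡1+2*j : ∀ j → j + suc j ≡ suc (2 * j)
  j+[1+j]≡1+2*j = solve-∀
  middle-symmetry : M C j ≡ M C suc j
  middle-symmetry = subst (λ n → n C j ≡ n C suc j) (j+[1+j]≡1+2*j j) ([m+n]Cm≡[m+n]Cn j (suc j))
ballot-reflection (suc j) (suc h) = begin
  (ballot M h + ballot M (suc (suc h))) + suc M C j
    ≡⟨ cong (_+_ (ballot M h + ballot M (suc (suc h)))) ([n+1]Ck≡nCk+nC[k-1] M j) ⟩
  (ballot M h + ballot M (suc (suc h))) + (M C j + binomℤ M (+ j -ℤ + 1))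
    ≡⟨ interchange (ballot M h) _ _ _ ⟩
  (ballot M h + M C j) + (ballot M (suc (suc h)) + binomℤ M (+ j -ℤ + 1))
    ≡⟨ cong₂ _+_ (ballot-reflection (suc j) h) lower ⟩
  M C suc j + M C j
    ≡⟨ +-comm (M C suc j) (M C j) ⟩
  M C j + M C suc j
    ≡⟨ nCk+nC[k+1]≡[n+1]C[k+1] M j ⟩
  suc M C suc j ∎
  where
  M = h + 2 * suc j
  interchange : ∀ a b c d → (a + b) + (c + d) ≡ (a + c) + (b + d)
  interchange = solve-∀
  shift : ∀ h j → suc (suc h) + 2 * j ≡ h + 2 * suc j
  shift = solve-∀
  lower : ballot M (suc (suc h)) + binomℤ M (+ j -ℤ + 1) ≡ M C j
  lower = subst (λ n → ballot n (suc (suc h)) + binomℤ n (+ j -ℤ + 1) ≡ n C j) (shift h j)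
    (ballot-reflection j (suc (suc h)))

ballot-formula : ∀ j h → suc (h + 2 * j) * ballot (h + 2 * j) h ≡ suc h * (suc (h + 2 * j) C j)
ballot-formula j h = +-cancelʳ-≡ (j * C₊ + j * C₊) _ _ (trans reflected (sym regrouped))
  where
  M  = h + 2 * j
  C₊ = suc M C j
  C₋ = binomℤ M (+ j -ℤ + 1)
  factor : ∀ m d c → m * d + (m * c + m * c) ≡ m * (d + c) + m * c
  factor = solve-∀
  reflected : suc M * ballot M h + (j * C₊ + j * C₊) ≡ suc M * C₊
  reflected = begin
    suc M * ballot M h + (j * C₊ + j * C₊)
      ≡⟨ cong (λ x → suc M * ballot M h + (x + x)) ([n+1]*nC[k-1]≡k*[n+1]Ck M j) ⟨
    suc M * ballot M h + (suc M * C₋ + suc M * C₋)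
      ≡⟨ factor (suc M) (ballot M h) C₋ ⟩
    suc M * (ballot M h + C₋) + suc M * C₋
      ≡⟨ cong (λ x → suc M * x + suc M * C₋) (ballot-reflection j h) ⟩
    suc M * (M C j) + suc M * C₋
      ≡⟨ *-distribˡ-+ (suc M) (M C j) C₋ ⟨
    suc M * (M C j + C₋)
      ≡⟨ cong (suc M *_) ([n+1]Ck≡nCk+nC[k-1] M j) ⟨
    suc M * C₊ ∎
  regroup : ∀ h j c → suc h * c + (j * c + j * c) ≡ suc (h + 2 * j) * c
  regroup = solve-∀
  regrouped : suc h * C₊ + (j * C₊ + j * C₊) ≡ suc M * C₊
  regrouped = regroup h j C₊

ballot-formula′ : ∀ j h → suc (j + h) * ballot (h + 2 * j) h ≡ suc h * ((h + 2 * j) C j)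
ballot-formula′ j h = *-cancelˡ-≡ _ _ (suc M) (begin
  suc M * (suc (j + h) * ballot M h)   ≡⟨ x∙yz≈y∙xz (suc M) (suc (j + h)) _ ⟩
  suc (j + h) * (suc M * ballot M h)   ≡⟨ cong (suc (j + h) *_) (ballot-formula j h) ⟩
  suc (j + h) * (suc h * (suc M C j))  ≡⟨ x∙yz≈y∙xz (suc (j + h)) (suc h) _ ⟩
  suc h * (suc (j + h) * (suc M C j))  ≡⟨ cong (suc h *_) complementary ⟩
  suc h * (suc M * (M C j))            ≡⟨ x∙yz≈y∙xz (suc h) (suc M) _ ⟩
  suc M * (suc h * (M C j))            ∎)
  where
  M = h + 2 * j
  rearrange : ∀ j h → j + h + j ≡ h + 2 * j
  rearrange = solve-∀
  complementary : suc (j + h) * (suc M C j) ≡ suc M * (M C j)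
  complementary = subst (λ n → suc (j + h) * (suc n C j) ≡ suc n * (n C j)) (rearrange j h)
    ([m+1]*[m+n+1]Cn≡[m+n+1]*[m+n]Cn (j + h) j)

2*[1+n]∸1≡1+2*n : ∀ n → 2 * suc n ∸ 1 ≡ suc (2 * n)
2*[1+n]∸1≡1+2*n n = cong (_∸ 1) (*-suc 2 n)

ballot[2n,2k] : ∀ n k → (n + suc k) * ballot (2 * n) (2 * k)
                      ≡ (2 * suc k ∸ 1) * binomℤ (2 * n) ((+ n -ℤ + suc k) +ℤ + 1)
ballot[2n,2k] n k with ≤-<-connex k n
ballot[2n,2k] n k | inj₁ k≤n with m≤n⇒∃[o]m+o≡n k≤n
ballot[2n,2k] _ k | inj₁ _ | J , refl = begin
  (k + J + suc k) * ballot (2 * (k + J)) (2 * k)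
    ≡⟨ cong₂ (λ a m → a * ballot m (2 * k)) (weight k J) (*-distribˡ-+ 2 k J) ⟩
  suc (J + 2 * k) * ballot (2 * k + 2 * J) (2 * k)
    ≡⟨ ballot-formula′ J (2 * k) ⟩
  suc (2 * k) * ((2 * k + 2 * J) C J)
    ≡⟨ cong₂ (λ a m → a * (m C J)) (sym (2*[1+n]∸1≡1+2*n k)) (sym (*-distribˡ-+ 2 k J)) ⟩
  (2 * suc k ∸ 1) * ((2 * (k + J)) C J)
    ≡⟨ cong (λ i → (2 * suc k ∸ 1) * binomℤ (2 * (k + J)) i) (index (+ k) (+ J)) ⟨
  (2 * suc k ∸ 1) * binomℤ (2 * (k + J)) ((+ (k + J) -ℤ + suc k) +ℤ + 1) ∎
  where
  weight : ∀ k J → k + J + suc k ≡ suc (J + 2 * k)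
  weight = solve-∀
  index : ∀ a b → ((a +ℤ b) -ℤ (+ 1 +ℤ a)) +ℤ + 1 ≡ b
  index = ℤ-Solver.solve-∀
ballot[2n,2k] n k | inj₂ n<k with m≤n⇒∃[o]m+o≡n n<k
ballot[2n,2k] n _ | inj₂ _ | d , refl = begin
  (n + suc (suc n + d)) * ballot (2 * n) (2 * suc (n + d))
    ≡⟨ cong ((n + suc (suc n + d)) *_) (ballot-vanishes (*-monoʳ-< 2 (s≤s (m≤m+n n d)))) ⟩
  (n + suc (suc n + d)) * 0
    ≡⟨ *-zeroʳ (n + suc (suc n + d)) ⟩
  0
    ≡⟨ *-zeroʳ (2 * suc (suc n + d) ∸ 1) ⟨
  (2 * suc (suc n + d) ∸ 1) * binomℤ (2 * n) -[1+ d ]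
    ≡⟨ cong (λ i → (2 * suc (suc n + d) ∸ 1) * binomℤ (2 * n) i) (index (+ n) (+ d)) ⟨
  (2 * suc (suc n + d) ∸ 1) * binomℤ (2 * n) ((+ n -ℤ + suc (suc n + d)) +ℤ + 1) ∎
  where
  index : ∀ a b → (a -ℤ (+ 1 +ℤ ((+ 1 +ℤ a) +ℤ b))) +ℤ + 1 ≡ - (+ 1 +ℤ b)
  index = ℤ-Solver.solve-∀

ballot[2n+1,2k+1] : ∀ n k → (n + 1) * ballot (suc (2 * n)) (suc (2 * k))
                          ≡ (k + 1) * binomℤ (2 * n + 2) (+ n -ℤ + k)
ballot[2n+1,2k+1] n k with ≤-<-connex k n
ballot[2n+1,2k+1] n k | inj₁ k≤n with m≤n⇒∃[o]m+o≡n k≤n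
ballot[2n+1,2k+1] _ k | inj₁ _ | J , refl = *-cancelˡ-≡ _ _ 2 (begin
  2 * ((k + J + 1) * ballot (suc (2 * (k + J))) (suc (2 * k)))
    ≡⟨ twice (k + J) _ ⟩
  suc (suc (2 * (k + J))) * ballot (suc (2 * (k + J))) (suc (2 * k))
    ≡⟨ cong (λ m → suc (suc m) * ballot (suc m) (suc (2 * k))) (*-distribˡ-+ 2 k J) ⟩
  suc (suc (2 * k + 2 * J)) * ballot (suc (2 * k + 2 * J)) (suc (2 * k))
    ≡⟨ ballot-formula J (suc (2 * k)) ⟩
  suc (suc (2 * k)) * (suc (suc (2 * k + 2 * J)) C J)
    ≡⟨ cong (λ m → suc (suc (2 * k)) * (m C J)) (plus-two k J) ⟩
  suc (suc (2 * k)) * ((2 * (k + J) + 2) C J)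
    ≡⟨ twice k _ ⟨
  2 * ((k + 1) * ((2 * (k + J) + 2) C J))
    ≡⟨ cong (λ i → 2 * ((k + 1) * binomℤ (2 * (k + J) + 2) i)) (index (+ k) (+ J)) ⟨
  2 * ((k + 1) * binomℤ (2 * (k + J) + 2) (+ (k + J) -ℤ + k)) ∎)
  where
  twice : ∀ x y → 2 * ((x + 1) * y) ≡ suc (suc (2 * x)) * y
  twice = solve-∀
  plus-two : ∀ k J → suc (suc (2 * k + 2 * J)) ≡ 2 * (k + J) + 2
  plus-two = solve-∀
  index : ∀ a b → (a +ℤ b) -ℤ a ≡ b
  index = ℤ-Solver.solve-∀
ballot[2n+1,2k+1] n k | inj₂ n<k with m≤n⇒∃[o]m+o≡n n<k
ballot[2n+1,2k+1] n _ | inj₂ _ | d , refl = begin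
  (n + 1) * ballot (suc (2 * n)) (suc (2 * (suc n + d)))
    ≡⟨ cong ((n + 1) *_) (ballot-vanishes (s≤s (*-monoʳ-< 2 (s≤s (m≤m+n n d))))) ⟩
  (n + 1) * 0
    ≡⟨ *-zeroʳ (n + 1) ⟩
  0
    ≡⟨ *-zeroʳ (suc n + d + 1) ⟨
  (suc n + d + 1) * binomℤ (2 * n + 2) -[1+ d ]
    ≡⟨ cong (λ i → (suc n + d + 1) * binomℤ (2 * n + 2) i) (index (+ n) (+ d)) ⟨
  (suc n + d + 1) * binomℤ (2 * n + 2) (+ n -ℤ + (suc n + d)) ∎
  where
  index : ∀ a b → a -ℤ ((+ 1 +ℤ a) +ℤ b) ≡ - (+ 1 +ℤ b)
  index = ℤ-Solver.solve-∀

ballot[2n+1,1] : ∀ n → (n + 2) * ballot (suc (2 * n)) 1 ≡ (2 * n + 2) C (n + 1)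
ballot[2n+1,1] n = *-cancelˡ-≡ _ _ (suc n) (begin
  suc n * ((n + 2) * b)                  ≡⟨ cong (λ x → suc n * (x * b)) (+-comm n 2) ⟩
  suc n * (suc (suc n) * b)              ≡⟨ x∙yz≈y∙xz (suc n) (suc (suc n)) b ⟩
  suc (suc n) * (suc n * b)              ≡⟨ cong (suc (suc n) *_) [n+1]*b≡[2n+2]Cn ⟩
  suc (suc n) * (suc T C n)              ≡⟨ [m+1]*[m+n+1]Cn≡[m+n+1]*[m+n]Cn (suc n) n ⟩
  suc T * (T C n)                        ≡⟨ [k+1]*[n+1]C[k+1]≡[n+1]*nCk T n ⟨
  suc n * (suc T C suc n)                ≡⟨ cong₂ (λ m i → suc n * (m C i)) (two-n-plus-two n) (+-comm 1 n) ⟩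
  suc n * ((2 * n + 2) C (n + 1))        ∎)
  where
  T = suc n + n
  b = ballot (suc (2 * n)) 1
  two-n-plus-two : ∀ n → suc (suc n + n) ≡ 2 * n + 2
  two-n-plus-two = solve-∀
  [n+1]*b≡[2n+2]Cn : suc n * b ≡ suc T C n
  [n+1]*b≡[2n+2]Cn = begin
    suc n * b                                  ≡⟨ cong (_* b) (+-comm 1 n) ⟩
    (n + 1) * b                                ≡⟨ ballot[2n+1,2k+1] n 0 ⟩
    1 * binomℤ (2 * n + 2) (+ n -ℤ + 0)        ≡⟨ *-identityˡ _ ⟩
    binomℤ (2 * n + 2) (+ n -ℤ + 0)
      ≡⟨ cong₂ binomℤ (sym (two-n-plus-two n)) (ℤ.+-identityʳ (+ n)) ⟩
    suc T C n                                  ∎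

Image : (Path → Path) → (Path → Set) → Path → Set
Image f P p = ∃ λ q → P q × p ≡ f q

HasCount-⇔ : ∀ {P Q n} → (∀ p → P p ⇔ Q p) → HasCount P n → HasCount Q n
HasCount-⇔ P⇔Q (L , unique , L⇔P , len) =
  L , unique , (λ p → mk⇔ (to (P⇔Q p) ∘′ to (L⇔P p)) (from (L⇔P p) ∘′ from (P⇔Q p))) , len


HasCount-⊥ : ∀ {P} → (∀ p → ¬ P p) → HasCount P 0
HasCount-⊥ ¬P = [] , [] , (λ p → mk⇔ (λ ()) (λ Pp → ⊥-elim (¬P p Pp))) , refl

HasCount-≡ : ∀ x → HasCount (_≡ x) 1
HasCount-≡ x = [ x ] , [] ∷ [] , (λ p → mk⇔ (λ { (here eq) → eq ; (there ()) }) here) , refl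

HasCount-image : ∀ {f P n} → (∀ {p q} → f p ≡ f q → p ≡ q) → HasCount P n → HasCount (Image f P) n
HasCount-image {f} {P} f-injective (L , unique , L⇔P , len) =
  map f L , map⁺ f-injective unique , (λ p → mk⇔ (image⁺ p) image⁻) , trans (length-map f L) len
  where
  image⁺ : ∀ p → p ∈ map f L → Image f P p
  image⁺ p p∈ with ∈-map⁻ f p∈
  ... | q , q∈L , refl = q , to (L⇔P q) q∈L , refl
  image⁻ : ∀ {p} → Image f P p → p ∈ map f L
  image⁻ (q , Pq , refl) = ∈-map⁺ f (from (L⇔P q) Pq)

HasCount-⊎ : ∀ {P Q a b} → HasCount P a → HasCount Q b → (∀ {p} → P p → Q p → ⊥) →
             HasCount (λ p → P p ⊎ Q p) (a + b)
HasCount-⊎ {P} {Q} (L , uL , L⇔P , lenL) (M , uM , M⇔Q , lenM) disjoint =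
  L ++ M , ++⁺ uL uM (λ (p∈L , p∈M) → disjoint (to (L⇔P _) p∈L) (to (M⇔Q _) p∈M)) ,
  (λ p → mk⇔ (union⁺ p) union⁻) , trans (length-++ L) (cong₂ _+_ lenL lenM)
  where
  union⁺ : ∀ p → p ∈ L ++ M → P p ⊎ Q p
  union⁺ p p∈ with ∈-++⁻ L p∈
  ... | inj₁ p∈L = inj₁ (to (L⇔P p) p∈L)
  ... | inj₂ p∈M = inj₂ (to (M⇔Q p) p∈M)
  union⁻ : ∀ {p} → P p ⊎ Q p → p ∈ L ++ M
  union⁻ {p} (inj₁ Pp) = ∈-++⁺ˡ (from (L⇔P p) Pp)
  union⁻ {p} (inj₂ Qp) = ∈-++⁺ʳ L (from (M⇔Q p) Qp)

-- Zigzag walks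

Ends : Bool → Path → Set
Ends b []          = ⊤
Ends b (s ∷ [])    = up s ≡ b
Ends b (_ ∷ t ∷ p) = Ends b (t ∷ p)

Zigzag : Path → Set
Zigzag p = StaysNonneg (+ 0) p × Alternating p

Walk : Bool → ℤ → Path → Set
Walk b k p = Zigzag p × endHeight p ≡ k × Ends b p

WalkOfLength : Bool → ℕ → ℤ → Path → Set
WalkOfLength b m k p = length p ≡ m × Walk b k p

length-∷ʳ : ∀ (q : Path) s → length (q ∷ʳ s) ≡ suc (length q)
length-∷ʳ q s = trans (length-++ q) (+-comm (length q) 1)

endFrom-∷ʳ : ∀ h q s → endFrom h (q ∷ʳ s) ≡ endFrom h q +ℤ dy s
endFrom-∷ʳ h []      s = refl
endFrom-∷ʳ h (t ∷ q) s = endFrom-∷ʳ (h +ℤ dy t) q s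

endFrom-nonneg : ∀ {h} q → + 0 ≤ h → StaysNonneg h q → + 0 ≤ endFrom h q
endFrom-nonneg []      0≤h _             = 0≤h
endFrom-nonneg (s ∷ q) _   (0≤h′ , rest) = endFrom-nonneg q 0≤h′ rest

StaysNonneg-++⁻ : ∀ h p q → StaysNonneg h (p ++ q) → StaysNonneg h p
StaysNonneg-++⁻ h []      q _              = tt
StaysNonneg-++⁻ h (s ∷ p) q (0≤h′ , rest) = 0≤h′ , StaysNonneg-++⁻ (h +ℤ dy s) p q rest

StaysNonneg-∷ʳ : ∀ h q s → StaysNonneg h q → + 0 ≤ endFrom h (q ∷ʳ s) → StaysNonneg h (q ∷ʳ s)
StaysNonneg-∷ʳ h []      s _              0≤end = 0≤end , tt
StaysNonneg-∷ʳ h (t ∷ q) s (0≤h′ , rest) 0≤end = 0≤h′ , StaysNonneg-∷ʳ (h +ℤ dy t) q s rest 0≤end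

Alternating-++⁻ : ∀ p q → Alternating (p ++ q) → Alternating p
Alternating-++⁻ []          q _            = tt
Alternating-++⁻ (s ∷ [])    q _            = tt
Alternating-++⁻ (s ∷ t ∷ p) q (s≁t , rest) = s≁t , Alternating-++⁻ (t ∷ p) q rest

Alternating-∷ʳ⁻ : ∀ q s → Alternating (q ∷ʳ s) → Ends (not (up s)) q
Alternating-∷ʳ⁻ []          s _         = tt
Alternating-∷ʳ⁻ (t ∷ [])    s (t≁s , _) = ¬-not t≁s
Alternating-∷ʳ⁻ (t ∷ u ∷ q) s (_ , rest) = Alternating-∷ʳ⁻ (u ∷ q) s rest

Alternating-∷ʳ⁺ : ∀ q s → Alternating q → Ends (not (up s)) q → Alternating (q ∷ʳ s)
Alternating-∷ʳ⁺ []          s _            _    = tt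
Alternating-∷ʳ⁺ (t ∷ [])    s _            ends = (λ t∼s → not-¬ refl (trans (sym t∼s) ends)) , tt
Alternating-∷ʳ⁺ (t ∷ u ∷ q) s (t≁u , rest) ends = t≁u , Alternating-∷ʳ⁺ (u ∷ q) s rest ends

Ends-∷ʳ : ∀ b q s → Ends b (q ∷ʳ s) ≡ (up s ≡ b)
Ends-∷ʳ b []          s = refl
Ends-∷ʳ b (t ∷ [])    s = refl
Ends-∷ʳ b (t ∷ u ∷ q) s = Ends-∷ʳ b (u ∷ q) s

Walk-nonneg : ∀ {b n p} → ¬ Walk b -[1+ n ] p
Walk-nonneg {p = p} ((nonneg , _) , end , _) with subst (+ 0 ≤_) end (endFrom-nonneg p (+≤+ z≤n) nonneg)
... | ()

Walk-∷ʳ : ∀ {b k} q s → + 0 ≤ k → Walk b k (q ∷ʳ s) ⇔ (up s ≡ b × Walk (not b) (- dy s +ℤ k) q)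
Walk-∷ʳ {b} {k} q s 0≤k = mk⇔ unsnoc snoc
  where
  shift-left : ∀ e d → e ≡ - d +ℤ (e +ℤ d)
  shift-left = ℤ-Solver.solve-∀
  shift-right : ∀ d k → (- d +ℤ k) +ℤ d ≡ k
  shift-right = ℤ-Solver.solve-∀
  unsnoc : Walk b k (q ∷ʳ s) → up s ≡ b × Walk (not b) (- dy s +ℤ k) q
  unsnoc ((nonneg , alternating) , end , ends) with subst id (Ends-∷ʳ b q s) ends
  ... | refl = refl , (StaysNonneg-++⁻ (+ 0) q [ s ] nonneg , Alternating-++⁻ q [ s ] alternating) ,
               end′ , Alternating-∷ʳ⁻ q s alternating
    where
    end′ : endHeight q ≡ - dy s +ℤ k
    end′ = trans (shift-left _ (dy s)) (cong (- dy s +ℤ_) (trans (sym (endFrom-∷ʳ (+ 0) q s)) end))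
  snoc : up s ≡ b × Walk (not b) (- dy s +ℤ k) q → Walk b k (q ∷ʳ s)
  snoc (refl , (nonneg , alternating) , end , ends) =
    (StaysNonneg-∷ʳ (+ 0) q s nonneg (subst (+ 0 ≤_) (sym end′) 0≤k) ,
     Alternating-∷ʳ⁺ q s alternating ends) ,
    end′ , subst id (sym (Ends-∷ʳ (up s) q s)) refl
    where
    end′ : endHeight (q ∷ʳ s) ≡ k
    end′ = trans (endFrom-∷ʳ (+ 0) q s) (trans (cong (_+ℤ dy s) end) (shift-right (dy s) k))

steep flat : Bool → Step
steep true  = N
steep false = N̄
flat true   = E
flat false  = Ē

up-steep : ∀ b → up (steep b) ≡ b
up-steep true  = refl
up-steep false = refl

up-flat : ∀ b → up (flat b) ≡ b
up-flat true  = refl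
up-flat false = refl

up≡⇒ : ∀ {b} s → up s ≡ b → s ≡ steep b ⊎ s ≡ flat b
up≡⇒ N refl = inj₁ refl
up≡⇒ N̄ refl = inj₁ refl
up≡⇒ E refl = inj₂ refl
up≡⇒ Ē refl = inj₂ refl

steep≢flat : ∀ b → steep b ≢ flat b
steep≢flat true  ()
steep≢flat false ()

Predecessor : Step → Bool → ℕ → ℕ → Path → Set
Predecessor s b m k = Image (_∷ʳ s) (WalkOfLength (not b) m (- dy s +ℤ + k))

WalkOfLength-suc : ∀ b m k p →
  WalkOfLength b (suc m) (+ k) p ⇔ (Predecessor (steep b) b m k p ⊎ Predecessor (flat b) b m k p)
WalkOfLength-suc b m k p = mk⇔ (unsnoc p) snoc
  where
  unsnoc : ∀ p → WalkOfLength b (suc m) (+ k) p → Predecessor (steep b) b m k p ⊎ Predecessor (flat b) b m k p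
  unsnoc p (len , w) with initLast p
  unsnoc _ (()  , w) | []
  ... | q ∷ʳ′ s with to (Walk-∷ʳ q s (+≤+ z≤n)) w
  ... | up-s , w′ = Sum.map (λ { refl → q , w″ , refl }) (λ { refl → q , w″ , refl }) (up≡⇒ s up-s)
    where
    w″ : WalkOfLength (not b) m (- dy s +ℤ + k) q
    w″ = suc-injective (trans (sym (length-∷ʳ q s)) len) , w′
  extend : ∀ s q → up s ≡ b →
           WalkOfLength (not b) m (- dy s +ℤ + k) q → WalkOfLength b (suc m) (+ k) (q ∷ʳ s)
  extend s q up-s (len , w) = trans (length-∷ʳ q s) (cong suc len) , from (Walk-∷ʳ q s (+≤+ z≤n)) (up-s , w)
  snoc : Predecessor (steep b) b m k p ⊎ Predecessor (flat b) b m k p → WalkOfLength b (suc m) (+ k) p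
  snoc (inj₁ (q , w , refl)) = extend (steep b) q (up-steep b) w
  snoc (inj₂ (q , w , refl)) = extend (flat b) q (up-flat b) w

WalkOfLength-zero : ∀ {b k p} → WalkOfLength b 0 k p → p ≡ [] × k ≡ + 0
WalkOfLength-zero {p = []} (_ , _ , end , _) = refl , sym end

walks : Bool → ℕ → ℤ → ℕ
walks _ _       -[1+ _ ]  = 0
walks _ zero    (+ zero)  = 1
walks _ zero    (+ suc _) = 0
walks b (suc m) (+ k)     =
  walks (not b) m (- dy (steep b) +ℤ + k) + walks (not b) m (- dy (flat b) +ℤ + k)

walks-count : ∀ b m k → HasCount (WalkOfLength b m k) (walks b m k)
walks-count b m       -[1+ n ]  = HasCount-⊥ (λ _ (_ , w) → Walk-nonneg w)
walks-count b zero    (+ zero)  = HasCount-⇔ empty (HasCount-≡ [])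
  where
  empty : ∀ p → p ≡ [] ⇔ WalkOfLength b 0 (+ 0) p
  empty p = mk⇔ (λ { refl → refl , (tt , tt) , refl , tt }) (proj₁ ∘′ WalkOfLength-zero)
walks-count b zero    (+ suc k) = HasCount-⊥ (λ _ w → case proj₂ (WalkOfLength-zero w) of λ ())
walks-count b (suc m) (+ k)     =
  HasCount-⇔ (λ p → ⇔-sym (WalkOfLength-suc b m k p))
    (HasCount-⊎ (HasCount-image (∷ʳ-injectiveˡ _ _) (walks-count (not b) m _))
                (HasCount-image (∷ʳ-injectiveˡ _ _) (walks-count (not b) m _))
                λ { (q , _ , refl) (q′ , _ , eq) → steep≢flat b (∷ʳ-injectiveʳ q q′ eq) })

descend : ∀ j {p} → Walk false (+ j) p → ∃ λ q → ZigzagKnightPath (p ++ q)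
descend zero    {p} ((nonneg , alternating) , end , _) =
  [] , subst ZigzagKnightPath (sym (++-identityʳ p)) ((nonneg , end) , alternating)
descend (suc j) {p} w with descend j (from (Walk-∷ʳ (p ∷ʳ E) N̄ (+≤+ z≤n)) (refl , up-E))
  where
  up-E : Walk true (+ suc (suc j)) (p ∷ʳ E)
  up-E = from (Walk-∷ʳ p E (+≤+ z≤n)) (refl , w)
... | q , zigzag =
  E ∷ N̄ ∷ q ,
  subst ZigzagKnightPath (trans (++-assoc (p ∷ʳ E) [ N̄ ] q) (++-assoc p [ E ] (N̄ ∷ q))) zigzag

complete : ∀ b k p → Walk b (+ k) p → PartialZigzag p
complete false k       p w = descend k w
complete true  (suc k) p w with descend k (from (Walk-∷ʳ p Ē (+≤+ z≤n)) (refl , w))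
... | q , zigzag = Ē ∷ q , subst ZigzagKnightPath (++-assoc p [ Ē ] q) zigzag
-- A nonempty walk whose last step goes up cannot end at height 0.
complete true  zero    p w with initLast p
complete true  zero    _ (zigzag , end , _) | [] = descend 0 (zigzag , end , tt)
... | q ∷ʳ′ s with to (Walk-∷ʳ q s (+≤+ z≤n)) w
... | up-s , w′ with up≡⇒ s up-s
... | inj₁ refl = ⊥-elim (Walk-nonneg w′)
... | inj₂ refl = ⊥-elim (Walk-nonneg w′)

Ends-last : ∀ p → ∃ λ b → Ends b p
Ends-last []          = true , tt
Ends-last (s ∷ [])    = up s , refl
Ends-last (_ ∷ t ∷ p) = Ends-last (t ∷ p)

PartialZigzag⇔Zigzag : ∀ p → PartialZigzag p ⇔ Zigzag p
PartialZigzag⇔Zigzag p = mk⇔ prefix extension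
  where
  prefix : PartialZigzag p → Zigzag p
  prefix (q , (nonneg , _) , alternating) = StaysNonneg-++⁻ (+ 0) p q nonneg , Alternating-++⁻ p q alternating
  extension : Zigzag p → PartialZigzag p
  extension zigzag@(nonneg , _) with Ends-last p
  ... | b , ends =
    complete b _ p (zigzag , sym (ℤ.0≤i⇒+∣i∣≡i (endFrom-nonneg p (+≤+ z≤n) nonneg)) , ends)

LastUpOrEmpty≡Ends : ∀ p → LastUpOrEmpty p ≡ Ends true p
LastUpOrEmpty≡Ends []          = refl
LastUpOrEmpty≡Ends (s ∷ [])    = refl
LastUpOrEmpty≡Ends (_ ∷ t ∷ p) = LastUpOrEmpty≡Ends (t ∷ p)

LastDown≡Ends : ∀ s p → LastDown (s ∷ p) ≡ Ends false (s ∷ p)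
LastDown≡Ends s []      = refl
LastDown≡Ends _ (t ∷ p) = LastDown≡Ends t p

CoefficientPath⇔WalkOfLength : ∀ {b m k p Last} → Last ≡ Ends b p →
  (PartialZigzag p × length p ≡ m × endHeight p ≡ + k × Last) ⇔ WalkOfLength b m (+ k) p
CoefficientPath⇔WalkOfLength {p = p} Last≡Ends = mk⇔
  (λ (partial , len , end , last) →
     len , to (PartialZigzag⇔Zigzag p) partial , end , subst id Last≡Ends last)
  (λ (len , zigzag , end , ends) →
     from (PartialZigzag⇔Zigzag p) zigzag , len , end , subst id (sym Last≡Ends) ends)

FPath⇔WalkOfLength : ∀ m k p → FPath m k p ⇔ WalkOfLength true m (+ k) p
FPath⇔WalkOfLength m k p = CoefficientPath⇔WalkOfLength (LastUpOrEmpty≡Ends p)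

GPath⇔WalkOfLength : ∀ m k p → GPath (suc m) k p ⇔ WalkOfLength false (suc m) (+ k) p
GPath⇔WalkOfLength m k []      = mk⇔ (λ ()) (λ ())
GPath⇔WalkOfLength m k (s ∷ p) = CoefficientPath⇔WalkOfLength (LastDown≡Ends s p)

fCoef-walks : ∀ m k → fCoef m k (walks true m (+ k))
fCoef-walks m k = HasCount-⇔ (λ p → ⇔-sym (FPath⇔WalkOfLength m k p)) (walks-count true m (+ k))

gCoef-walks : ∀ m k → gCoef (suc m) k (walks false (suc m) (+ k))
gCoef-walks m k = HasCount-⇔ (λ p → ⇔-sym (GPath⇔WalkOfLength m k p)) (walks-count false (suc m) (+ k))

walks-false≡ballot : ∀ m k → walks false m (+ k) ≡ ballot (suc m) (suc (2 * k))
walks-true≡ballot  : ∀ m k → walks true m (+ suc k) ≡ ballot (suc m) (2 * k)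

walks-false≡ballot zero    zero    = refl
walks-false≡ballot zero    (suc k) = refl
walks-false≡ballot (suc m) k       = begin
  walks true m (+ suc (suc k)) + walks true m (+ suc k)
    ≡⟨ cong₂ _+_ (walks-true≡ballot m (suc k)) (walks-true≡ballot m k) ⟩
  ballot (suc m) (2 * suc k) + ballot (suc m) (2 * k)
    ≡⟨ +-comm _ (ballot (suc m) (2 * k)) ⟩
  ballot (suc m) (2 * k) + ballot (suc m) (2 * suc k)
    ≡⟨ cong (λ h → ballot (suc m) (2 * k) + ballot (suc m) h) (*-suc 2 k) ⟩
  ballot (suc (suc m)) (suc (2 * k)) ∎

walks-true≡ballot zero    zero    = refl
walks-true≡ballot zero    (suc k) = sym (cong (ballot 1) (*-suc 2 k))
walks-true≡ballot (suc m) zero    = walks-false≡ballot m 0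
walks-true≡ballot (suc m) (suc k) = begin
  walks false m (+ k) + walks false m (+ suc k)
    ≡⟨ cong₂ _+_ (walks-false≡ballot m k) (walks-false≡ballot m (suc k)) ⟩
  ballot (suc m) (suc (2 * k)) + ballot (suc m) (suc (2 * suc k))
    ≡⟨ cong (λ h → ballot (suc m) (suc (2 * k)) + ballot (suc m) (suc h)) (*-suc 2 k) ⟩
  ballot (suc (suc m)) (2 + 2 * k)
    ≡⟨ cong (ballot (suc (suc m))) (*-suc 2 k) ⟨
  ballot (suc (suc m)) (2 * suc k) ∎

walks-true-even : ∀ m k → walks true (2 * m) (+ suc k) ≡ 0
walks-false-odd : ∀ m k → walks false (suc (2 * m)) k ≡ 0

walks-true-even zero    k = refl
walks-true-even (suc m) k = subst (λ n → walks true n (+ suc k) ≡ 0) (sym (*-suc 2 m))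
  (cong₂ _+_ (walks-false-odd m (-[1+ 1 ] +ℤ + suc k)) (walks-false-odd m (+ k)))

walks-false-odd m -[1+ _ ] = refl
walks-false-odd m (+ k)    = cong₂ _+_ (walks-true-even m (suc k)) (walks-true-even m k)

[z⁰]f₀ : fCoef 0 0 1
[z⁰]f₀ = fCoef-walks 0 0

[z²ⁿ⁻¹]fₖ : ∀ n k → n ≥ 1 → k ≥ 1 → Σ ℕ λ c → fCoef (2 * n ∸ 1) k c
  × (n + k) * c ≡ (2 * k ∸ 1) * binomℤ (2 * n) ((+ n -ℤ + k) +ℤ + 1)
[z²ⁿ⁻¹]fₖ (suc n) (suc k) _ _ = _ , fCoef-walks _ _ ,
  trans (cong ((suc n + suc k) *_) (walks-true≡ballot (2 * suc n ∸ 1) k)) (ballot[2n,2k] (suc n) k)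

[z²ⁿ]g₀ : ∀ n → n ≥ 1 → Σ ℕ λ c → gCoef (2 * n) 0 c × (n + 2) * c ≡ (2 * n + 2) C (n + 1)
[z²ⁿ]g₀ (suc n) _ = _ , gCoef-walks _ 0 ,
  trans (cong ((suc n + 2) *_) (walks-false≡ballot (2 * suc n) 0)) (ballot[2n+1,1] (suc n))

[z²ⁿ]gₖ : ∀ n k → n ≥ 1 → k ≥ 1 → Σ ℕ λ c → gCoef (2 * n) k c
  × (n + 1) * c ≡ (k + 1) * binomℤ (2 * n + 2) (+ n -ℤ + k)
[z²ⁿ]gₖ (suc n) k _ _ = _ , gCoef-walks _ k ,
  trans (cong ((suc n + 1) *_) (walks-false≡ballot (2 * suc n) k)) (ballot[2n+1,2k+1] (suc n) k)

[zᵐ]f₀ : ∀ m → m ≥ 1 → fCoef m 0 0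
[zᵐ]f₀ (suc m) _ = fCoef-walks (suc m) 0

[z²ⁿ]fₖ : ∀ n k → k ≥ 1 → fCoef (2 * n) k 0
[z²ⁿ]fₖ n (suc k) _ = subst (fCoef (2 * n) (suc k)) (walks-true-even n k) (fCoef-walks (2 * n) (suc k))

[z²ⁿ⁻¹]gₖ : ∀ n k → n ≥ 1 → gCoef (2 * n ∸ 1) k 0
[z²ⁿ⁻¹]gₖ (suc n) k _ = subst (λ m → gCoef m k 0) (sym (2*[1+n]∸1≡1+2*n n))
  (subst (gCoef (suc (2 * n)) k) (walks-false-odd n (+ k)) (gCoef-walks (2 * n) k))

[z⁰]gₖ : ∀ k → gCoef 0 k 0
[z⁰]gₖ k = HasCount-⊥ λ { [] (_ , _ , _ , ()) ; (_ ∷ _) (_ , () , _) }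

corollary5 : fCoef 0 0 1
    × (∀ n k → n ≥ 1 → k ≥ 1 → Σ ℕ λ c → fCoef (2 * n ∸ 1) k c
         × (n + k) * c ≡ (2 * k ∸ 1) * binomℤ (2 * n) ((+ n -ℤ + k) +ℤ + 1))
    × (∀ n → n ≥ 1 → Σ ℕ λ c → gCoef (2 * n) 0 c
         × (n + 2) * c ≡ (2 * n + 2) C (n + 1))
    × (∀ n k → n ≥ 1 → k ≥ 1 → Σ ℕ λ c → gCoef (2 * n) k c
         × (n + 1) * c ≡ (k + 1) * binomℤ (2 * n + 2) (+ n -ℤ + k))
    × (∀ m → m ≥ 1 → fCoef m 0 0)
    × (∀ n k → k ≥ 1 → fCoef (2 * n) k 0)
    × (∀ n k → n ≥ 1 → gCoef (2 * n ∸ 1) k 0)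
    × (∀ k → gCoef 0 k 0)
corollary5 = [z⁰]f₀ , [z²ⁿ⁻¹]fₖ , [z²ⁿ]g₀ , [z²ⁿ]gₖ , [zᵐ]f₀ , [z²ⁿ]fₖ , [z²ⁿ⁻¹]gₖ , [z⁰]gₖ
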